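{- Let $k,r\geq 1$ and let $m=\lceil r/2\rceil$. Then $$\psi_{(3,2^k,1^r)}=\begin{cases}\big[\psi_{(2^{m+k+1})}-h_2p_1^{r+1}\psi_{(2^k)}\big]+p_1^r(2h_3+e_3)\psi_{(2^k)}, & r\text{ odd},\\ p_1\big[\psi_{(2^{m+k+1})}-h_2p_1^{r}\psi_{(2^k)}\big]+p_1^r(2h_3+e_3)\psi_{(2^k)}, & r\text{ even}.\end{cases}$$
   Context: Reverse lexicographic order on partitions of $N$: $\lambda>\mu$ if $\lambda_1>\mu_1$, or there is $j\geq 2$ with $\lambda_i=\mu_i$ for $i<j$ and $\lambda_j>\mu_j$. For a partition $\mu$ of $N$, $\psi_\mu=\sum_{\lambda\vdash N,\,(1^N)\le\lambda\le\mu}p_\lambda$, where $p_\lambda$ are power sums. In particular $\psi_{(2^j)}=\sum_{i=0}^j p_2^ip_1^{2j-2i}$. $h_n,e_n$ are the complete homogeneous and elementary symmetric functions. -}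

module Defs where

open import Data.Bool using (Bool; true; false; if_then_else_; _∧_)
open import Data.Nat as ℕ using (ℕ; zero; suc; _∸_; _≤ᵇ_; _<ᵇ_; _≡ᵇ_)
open import Data.Integer as ℤ using (ℤ; +_; _+_; _*_; _-_; _^_)
open import Data.List as List using (List; []; _∷_; map; foldr; concatMap; applyUpTo; filterᵇ; replicate)

-- Symmetric functions are modelled by their evaluations at arbitrary
-- finite lists of integer variables  xs = (x₁,…,xₙ)  (any n).
-- Since ℤ is infinite and a symmetric-function identity holds in Λ iff it
-- holds in every finite number of variables, an identity f = g in Λ is
-- the statement  ∀ xs → f xs ≡ g xs.

SymFun : Set
SymFun = List ℤ → ℤ

Σℤ : List ℤ → ℤ
Σℤ = foldr _+_ (+ 0)

Πℤ : List ℤ → ℤ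
Πℤ = foldr _*_ (+ 1)

p : ℕ → SymFun
p i xs = Σℤ (map (λ x → x ^ i) xs)

h : ℕ → SymFun
h zero      _        = + 1
h (suc d)   []       = + 0
h (suc d)   (x ∷ xs) = h (suc d) xs + x * h d (x ∷ xs)

e : ℕ → SymFun
e zero      _        = + 1
e (suc d)   []       = + 0
e (suc d)   (x ∷ xs) = e (suc d) xs + x * e d xs

-- Partitions as weakly decreasing lists of positive naturals.

-- partitionsFuel f n m : all partitions of n with all parts ≤ m
-- (listed in weakly decreasing order); the fuel f ≥ n guarantees termination.
partitionsFuel : ℕ → ℕ → ℕ → List (List ℕ)
partitionsFuel _       zero      _ = [] ∷ []
partitionsFuel zero    (suc n)   _ = []
partitionsFuel (suc f) (suc n)   m =
  concatMap (λ j → map (j ∷_) (partitionsFuel f (suc n ∸ j) j))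
            (filterᵇ (λ j → j ≤ᵇ suc n) (applyUpTo suc m))

partitions : ℕ → List (List ℕ)
partitions N = partitionsFuel N N N

revlex≤ : List ℕ → List ℕ → Bool
revlex≤ []       _        = true
revlex≤ (a ∷ as) []       = false
revlex≤ (a ∷ as) (b ∷ bs) =
  if a <ᵇ b then true else (if a ≡ᵇ b then revlex≤ as bs else false)

size : List ℕ → ℕ
size = foldr ℕ._+_ 0

pλ : List ℕ → SymFun
pλ λ′ xs = Πℤ (map (λ i → p i xs) λ′)

ψ : List ℕ → SymFun
ψ μ xs =
  Σℤ (map (λ λ′ → pλ λ′ xs)
          (filterᵇ (λ λ′ → revlex≤ (replicate (size μ) 1) λ′ ∧ revlex≤ λ′ μ)
                   (partitions (size μ))))

twos : ℕ → List ℕ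
twos j = replicate j 2

shape : ℕ → ℕ → List ℕ
shape k r = 3 ∷ (replicate k 2 List.++ replicate r 1)

{-# OPTIONS --safe #-}
-- A partition of N = 3 + 2k + r lies below (3, 2^k, 1^r) in reverse lexicographic order
-- iff all its parts are ≤ 2, or it is 3 followed by a partition below (2^k, 1^r); the
-- partitions below (2^j, 1^r) are the (2^i, 1^(2j-2i+r)) with i ≤ j. Hence
-- ψ_(3,2^k,1^r) = pParts≤2 N + p₃ p₁^r ψ_(2^k), where pParts≤2 n sums p_λ over all λ ⊢ n
-- with parts ≤ 2, and pParts≤2 (2M) = ψ_(2^M), pParts≤2 (2M+1) = p₁ ψ_(2^M). Taking
-- M = ⌈r/2⌉ + k + 1 gives the claim once 2h₃ + e₃ = p₃ + p₁h₂ collapses the correction terms.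
-- Each sum over partitionsFuel is computed by splitting off the first part: revlex≤ against
-- a concrete partition then decides by computation which first parts survive.
module Submission where

open import Defs
open import Data.Nat as ℕ using (ℕ; _≤_; _%_; ⌈_/2⌉)
open import Data.Integer using (ℤ; +_; _+_; _*_; _-_; _^_)
open import Data.List using (List)
open import Data.Product using (_×_)
open import Relation.Binary.PropositionalEquality using (_≡_)

open import Data.Bool using (Bool; true; false; T; _∧_)
open import Data.Product using (_,_)
open import Data.Nat using (zero; suc; z≤n; s≤s; _∸_; _≤ᵇ_)
open import Data.Nat.Properties using (+-suc; ≤-refl; ≤-trans; n≤1+n)
open import Data.Nat.ListAction.Properties using (sum-++)
import Data.Nat.Tactic.RingSolver as ℕ-Solver
open import Data.Integer.Properties
  using (+-identityˡ; +-identityʳ; +-assoc; +-comm; *-identityˡ; *-identityʳ; *-zeroʳ; *-distribˡ-+; ^-distribˡ-+-*)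
open import Data.Integer.Tactic.RingSolver using (solve-∀)
open import Data.List using ([]; _∷_; _++_; map; concatMap; applyUpTo; filterᵇ; replicate)
open import Data.List.Properties using (map-++; filter-++; filter-none; filter-accept; ++-identityʳ)
open import Data.List.Relation.Unary.All as All using (All)
open import Data.List.Relation.Unary.All.Properties using (applyUpTo⁺₂; filter⁺)
open import Data.Unit using (tt)
open import Function using (_∘_)
open import Relation.Nullary.Decidable using (T?)
open import Relation.Binary.PropositionalEquality using (refl; sym; trans; cong; cong₂; subst; module ≡-Reasoning)

open ≡-Reasoning

Σℤ-++ : ∀ (as bs : List ℤ) → Σℤ (as ++ bs) ≡ Σℤ as + Σℤ bs
Σℤ-++ []       bs = sym (+-identityˡ _)
Σℤ-++ (a ∷ as) bs = trans (cong (_+_ a) (Σℤ-++ as bs)) (sym (+-assoc a _ _))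

Σℤ-map-vanishing : ∀ {A : Set} (F : A → ℤ) {as} → All (λ a → F a ≡ + 0) as → Σℤ (map F as) ≡ + 0
Σℤ-map-vanishing F All.[]             = refl
Σℤ-map-vanishing F (Fa≡0 All.∷ Fas≡0) = cong₂ _+_ Fa≡0 (Σℤ-map-vanishing F Fas≡0)

applyUpTo-+ : ∀ {A : Set} (g : ℕ → A) c m →
              applyUpTo g (c ℕ.+ m) ≡ applyUpTo g c ++ applyUpTo (λ i → g (c ℕ.+ i)) m
applyUpTo-+ g zero    m = refl
applyUpTo-+ g (suc c) m = cong (g 0 ∷_) (applyUpTo-+ (g ∘ suc) c m)

revlex≤-ones-refl : ∀ n → revlex≤ (replicate n 1) (replicate n 1) ≡ true
revlex≤-ones-refl zero    = refl
revlex≤-ones-refl (suc n) = revlex≤-ones-refl n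

twosOnes : ℕ → ℕ → List ℕ
twosOnes j r = replicate j 2 ++ replicate r 1

size-twos : ∀ j → size (twos j) ≡ j ℕ.+ j
size-twos zero    = refl
size-twos (suc j) = cong suc (trans (cong suc (size-twos j)) (sym (+-suc j j)))

size-ones : ∀ r → size (replicate r 1) ≡ r
size-ones zero    = refl
size-ones (suc r) = cong suc (size-ones r)

size-twosOnes : ∀ j r → size (twosOnes j r) ≡ j ℕ.+ j ℕ.+ r
size-twosOnes j r = trans (sum-++ (twos j) (replicate r 1)) (cong₂ ℕ._+_ (size-twos j) (size-ones r))

n%2≡0⇒⌈n/2⌉+⌈n/2⌉≡n : ∀ n → n % 2 ≡ 0 → ⌈ n /2⌉ ℕ.+ ⌈ n /2⌉ ≡ n
n%2≡0⇒⌈n/2⌉+⌈n/2⌉≡n zero          _     = refl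
n%2≡0⇒⌈n/2⌉+⌈n/2⌉≡n (suc (suc n)) n%2≡0 =
  cong suc (trans (+-suc ⌈ n /2⌉ ⌈ n /2⌉) (cong suc (n%2≡0⇒⌈n/2⌉+⌈n/2⌉≡n n n%2≡0)))

n%2≡1⇒⌈n/2⌉+⌈n/2⌉≡1+n : ∀ n → n % 2 ≡ 1 → ⌈ n /2⌉ ℕ.+ ⌈ n /2⌉ ≡ suc n
n%2≡1⇒⌈n/2⌉+⌈n/2⌉≡1+n (suc zero)    _     = refl
n%2≡1⇒⌈n/2⌉+⌈n/2⌉≡1+n (suc (suc n)) n%2≡1 =
  cong suc (trans (+-suc ⌈ n /2⌉ ⌈ n /2⌉) (cong suc (n%2≡1⇒⌈n/2⌉+⌈n/2⌉≡1+n n n%2≡1)))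

size-shape-odd : ∀ k r → r % 2 ≡ 1 → 3 ℕ.+ (k ℕ.+ k ℕ.+ r) ≡ (⌈ r /2⌉ ℕ.+ k ℕ.+ 1) ℕ.+ (⌈ r /2⌉ ℕ.+ k ℕ.+ 1)
size-shape-odd k r r-odd = rearrange ⌈ r /2⌉ (n%2≡1⇒⌈n/2⌉+⌈n/2⌉≡1+n r r-odd)
  where
  rearrange : ∀ c → c ℕ.+ c ≡ suc r → 3 ℕ.+ (k ℕ.+ k ℕ.+ r) ≡ (c ℕ.+ k ℕ.+ 1) ℕ.+ (c ℕ.+ k ℕ.+ 1)
  rearrange c c+c≡1+r = begin
    3 ℕ.+ (k ℕ.+ k ℕ.+ r)         ≡⟨ ℕ-Solver.solve (k ∷ r ∷ []) ⟩
    suc r ℕ.+ (2 ℕ.+ (k ℕ.+ k))   ≡⟨ cong (ℕ._+ (2 ℕ.+ (k ℕ.+ k))) (sym c+c≡1+r) ⟩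
    c ℕ.+ c ℕ.+ (2 ℕ.+ (k ℕ.+ k)) ≡⟨ ℕ-Solver.solve (c ∷ k ∷ []) ⟩
    (c ℕ.+ k ℕ.+ 1) ℕ.+ (c ℕ.+ k ℕ.+ 1) ∎

size-shape-even : ∀ k r → r % 2 ≡ 0 → 3 ℕ.+ (k ℕ.+ k ℕ.+ r) ≡ suc ((⌈ r /2⌉ ℕ.+ k ℕ.+ 1) ℕ.+ (⌈ r /2⌉ ℕ.+ k ℕ.+ 1))
size-shape-even k r r-even = rearrange ⌈ r /2⌉ (n%2≡0⇒⌈n/2⌉+⌈n/2⌉≡n r r-even)
  where
  rearrange : ∀ c → c ℕ.+ c ≡ r → 3 ℕ.+ (k ℕ.+ k ℕ.+ r) ≡ suc ((c ℕ.+ k ℕ.+ 1) ℕ.+ (c ℕ.+ k ℕ.+ 1))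
  rearrange c c+c≡r = begin
    3 ℕ.+ (k ℕ.+ k ℕ.+ r)         ≡⟨ ℕ-Solver.solve (k ∷ r ∷ []) ⟩
    r ℕ.+ (3 ℕ.+ (k ℕ.+ k))       ≡⟨ cong (ℕ._+ (3 ℕ.+ (k ℕ.+ k))) (sym c+c≡r) ⟩
    c ℕ.+ c ℕ.+ (3 ℕ.+ (k ℕ.+ k)) ≡⟨ ℕ-Solver.solve (c ∷ k ∷ []) ⟩
    suc ((c ℕ.+ k ℕ.+ 1) ℕ.+ (c ℕ.+ k ℕ.+ 1)) ∎

module _ (xs : List ℤ) where

  private
    p₁ p₂ p₃ : ℤ
    p₁ = p 1 xs
    p₂ = p 2 xs
    p₃ = p 3 xs

    pλₓ : List ℕ → ℤ
    pλₓ λ′ = pλ λ′ xs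

  pSum : (List ℕ → Bool) → List (List ℕ) → ℤ
  pSum b Λ = Σℤ (map pλₓ (filterᵇ b Λ))

  pSum-++ : ∀ b Λ Λ′ → pSum b (Λ ++ Λ′) ≡ pSum b Λ + pSum b Λ′
  pSum-++ b Λ Λ′ = begin
    Σℤ (map pλₓ (filterᵇ b (Λ ++ Λ′)))                   ≡⟨ cong (Σℤ ∘ map pλₓ) (filter-++ (T? ∘ b) Λ Λ′) ⟩
    Σℤ (map pλₓ (filterᵇ b Λ ++ filterᵇ b Λ′))           ≡⟨ cong Σℤ (map-++ pλₓ (filterᵇ b Λ) _) ⟩
    Σℤ (map pλₓ (filterᵇ b Λ) ++ map pλₓ (filterᵇ b Λ′)) ≡⟨ Σℤ-++ (map pλₓ (filterᵇ b Λ)) _ ⟩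
    pSum b Λ + pSum b Λ′                                 ∎

  pSum-map-∷ : ∀ b j Λ → pSum b (map (j ∷_) Λ) ≡ p j xs * pSum (λ l → b (j ∷ l)) Λ
  pSum-map-∷ b j []      = sym (*-zeroʳ (p j xs))
  pSum-map-∷ b j (l ∷ Λ) with b (j ∷ l)
  ... | true  = trans (cong (_+_ (pλₓ (j ∷ l))) (pSum-map-∷ b j Λ))
                      (sym (*-distribˡ-+ (p j xs) (pλₓ l) _))
  ... | false = pSum-map-∷ b j Λ

  pSum-concatMap-∷ : ∀ b (Λ : ℕ → List (List ℕ)) js →
    pSum b (concatMap (λ j → map (j ∷_) (Λ j)) js) ≡
    Σℤ (map (λ j → p j xs * pSum (λ l → b (j ∷ l)) (Λ j)) js)
  pSum-concatMap-∷ b Λ []       = refl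
  pSum-concatMap-∷ b Λ (j ∷ js) =
    trans (pSum-++ b (map (j ∷_) (Λ j)) _) (cong₂ _+_ (pSum-map-∷ b j (Λ j)) (pSum-concatMap-∷ b Λ js))

  pSum-reject : ∀ {b} Λ → (∀ l → b l ≡ false) → pSum b Λ ≡ + 0
  pSum-reject {b} Λ b≡false =
    cong (Σℤ ∘ map pλₓ) (filter-none (T? ∘ b) (All.universal (λ l → subst T (b≡false l)) Λ))

  pSum-partitionsFuel : ∀ b f n m →
    pSum b (partitionsFuel (suc f) (suc n) m) ≡
    Σℤ (map (λ j → p j xs * pSum (λ l → b (j ∷ l)) (partitionsFuel f (suc n ∸ j) j))
            (filterᵇ (_≤ᵇ suc n) (applyUpTo suc m)))
  pSum-partitionsFuel b f n m =
    pSum-concatMap-∷ b (λ j → partitionsFuel f (suc n ∸ j) j) (filterᵇ (_≤ᵇ suc n) (applyUpTo suc m))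

  pSum-firstParts≤ : ∀ c {b} f n m → (∀ i l → b (suc (c ℕ.+ i) ∷ l) ≡ false) →
    pSum b (partitionsFuel (suc f) (suc n) (c ℕ.+ m)) ≡
    Σℤ (map (λ j → p j xs * pSum (λ l → b (j ∷ l)) (partitionsFuel f (suc n ∸ j) j))
            (filterᵇ (_≤ᵇ suc n) (applyUpTo suc c)))
  pSum-firstParts≤ c {b} f n m large-rejected = begin
    pSum b (partitionsFuel (suc f) (suc n) (c ℕ.+ m))
      ≡⟨ pSum-partitionsFuel b f n (c ℕ.+ m) ⟩
    Σℤ (map term (filterᵇ q (applyUpTo suc (c ℕ.+ m))))
      ≡⟨ cong (Σℤ ∘ map term ∘ filterᵇ q) (applyUpTo-+ suc c m) ⟩
    Σℤ (map term (filterᵇ q (applyUpTo suc c ++ large)))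
      ≡⟨ cong (Σℤ ∘ map term) (filter-++ (T? ∘ q) (applyUpTo suc c) large) ⟩
    Σℤ (map term (small ++ filterᵇ q large))
      ≡⟨ trans (cong Σℤ (map-++ term small (filterᵇ q large))) (Σℤ-++ (map term small) _) ⟩
    Σℤ (map term small) + Σℤ (map term (filterᵇ q large))
      ≡⟨ cong (_+_ (Σℤ (map term small)))
              (Σℤ-map-vanishing term (filter⁺ (T? ∘ q) (applyUpTo⁺₂ (λ i → suc (c ℕ.+ i)) m term-large≡0))) ⟩
    Σℤ (map term small) + + 0
      ≡⟨ +-identityʳ (Σℤ (map term small)) ⟩
    Σℤ (map term small) ∎
    where
    q : ℕ → Bool
    q = _≤ᵇ suc n
    Λ : ℕ → List (List ℕ)
    Λ j = partitionsFuel f (suc n ∸ j) j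
    term : ℕ → ℤ
    term j = p j xs * pSum (λ l → b (j ∷ l)) (Λ j)
    small large : List ℕ
    small = filterᵇ q (applyUpTo suc c)
    large = applyUpTo (λ i → suc (c ℕ.+ i)) m
    term-large≡0 : ∀ i → term (suc (c ℕ.+ i)) ≡ + 0
    term-large≡0 i = trans (cong (_*_ (p (suc (c ℕ.+ i)) xs)) (pSum-reject (Λ (suc (c ℕ.+ i))) (large-rejected i)))
                           (*-zeroʳ (p (suc (c ℕ.+ i)) xs))

  pSum-ones : ∀ {b} f n → n ≤ f → b (replicate n 1) ≡ true → pSum b (partitionsFuel f n 1) ≡ p₁ ^ n
  pSum-ones {b} f zero _ b[]≡true = cong (Σℤ ∘ map pλₓ) (filter-accept (T? ∘ b) (subst T (sym b[]≡true) tt))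
  pSum-ones {b} (suc f) (suc n) (s≤s n≤f) b-ones = begin
    pSum b (partitionsFuel (suc f) (suc n) 1)                    ≡⟨ pSum-partitionsFuel b f n 1 ⟩
    p₁ * pSum (λ l → b (1 ∷ l)) (partitionsFuel f n 1) + + 0 ≡⟨ +-identityʳ _ ⟩
    p₁ * pSum (λ l → b (1 ∷ l)) (partitionsFuel f n 1)       ≡⟨ cong (_*_ (p₁)) (pSum-ones f n n≤f b-ones) ⟩
    p₁ ^ suc n                                               ∎

  pParts≤2 : ℕ → ℤ
  pParts≤2 zero          = + 1
  pParts≤2 (suc zero)    = p₁
  pParts≤2 (suc (suc n)) = p₁ ^ suc (suc n) + p₂ * pParts≤2 n

  pParts≤2-suc+suc : ∀ j → pParts≤2 (suc j ℕ.+ suc j) ≡ p₁ ^ suc (suc (j ℕ.+ j)) + p₂ * pParts≤2 (j ℕ.+ j)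
  pParts≤2-suc+suc j = cong (pParts≤2 ∘ suc) (+-suc j j)

  pParts≤2-odd : ∀ j → pParts≤2 (suc (j ℕ.+ j)) ≡ p₁ * pParts≤2 (j ℕ.+ j)
  pParts≤2-odd zero    = sym (*-identityʳ (p₁))
  pParts≤2-odd (suc j) = begin
    pParts≤2 (suc (suc j ℕ.+ suc j))
      ≡⟨ cong (pParts≤2 ∘ suc ∘ suc) (+-suc j j) ⟩
    p₁ * p₁ ^ suc (suc (j ℕ.+ j)) + p₂ * pParts≤2 (suc (j ℕ.+ j))
      ≡⟨ cong (λ P → p₁ * p₁ ^ suc (suc (j ℕ.+ j)) + p₂ * P) (pParts≤2-odd j) ⟩
    p₁ * p₁ ^ suc (suc (j ℕ.+ j)) + p₂ * (p₁ * pParts≤2 (j ℕ.+ j))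
      ≡⟨ factor-p₁ (p₁) (p₁ ^ suc (suc (j ℕ.+ j))) (p₂) (pParts≤2 (j ℕ.+ j)) ⟩
    p₁ * (p₁ ^ suc (suc (j ℕ.+ j)) + p₂ * pParts≤2 (j ℕ.+ j))
      ≡⟨ cong (_*_ (p₁)) (sym (pParts≤2-suc+suc j)) ⟩
    p₁ * pParts≤2 (suc j ℕ.+ suc j) ∎
    where
    factor-p₁ : ∀ P₁ X P₂ Y → P₁ * X + P₂ * (P₁ * Y) ≡ P₁ * (X + P₂ * Y)
    factor-p₁ = solve-∀

  pSum-parts≤2 : ∀ f n → n ≤ f → pSum (λ _ → true) (partitionsFuel f n 2) ≡ pParts≤2 n
  pSum-parts≤2 f       zero          _         = refl
  pSum-parts≤2 (suc f) (suc zero)    _         = trans (+-identityʳ _) (*-identityʳ (p₁))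
  pSum-parts≤2 (suc f) (suc (suc n)) (s≤s n≤f) = begin
    pSum (λ _ → true) (partitionsFuel (suc f) (suc (suc n)) 2)
      ≡⟨ pSum-partitionsFuel (λ _ → true) f (suc n) 2 ⟩
    p₁ * pSum (λ _ → true) (partitionsFuel f (suc n) 1) + (p₂ * pSum (λ _ → true) (partitionsFuel f n 2) + + 0)
      ≡⟨ cong₂ (λ X Y → p₁ * X + (p₂ * Y + + 0))
               (pSum-ones f (suc n) n≤f refl) (pSum-parts≤2 f n (≤-trans (n≤1+n n) n≤f)) ⟩
    p₁ ^ suc (suc n) + (p₂ * pParts≤2 n + + 0)
      ≡⟨ cong (_+_ (p₁ ^ suc (suc n))) (+-identityʳ _) ⟩
    pParts≤2 (suc (suc n)) ∎

  pSum-revlex≤-ones : ∀ r f m → 1 ≤ m → size (replicate r 1) ≤ f →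
    pSum (λ λ′ → revlex≤ λ′ (replicate r 1)) (partitionsFuel f (size (replicate r 1)) m) ≡ p₁ ^ r
  pSum-revlex≤-ones zero    f       m       _         _         = refl
  pSum-revlex≤-ones (suc r) (suc f) (suc m) (s≤s z≤n) (s≤s S≤f) = begin
    pSum (λ λ′ → revlex≤ λ′ (replicate (suc r) 1)) (partitionsFuel (suc f) (suc S) (1 ℕ.+ m))
      ≡⟨ pSum-firstParts≤ 1 f S m (λ _ _ → refl) ⟩
    p₁ * pSum (λ λ′ → revlex≤ λ′ (replicate r 1)) (partitionsFuel f S 1) + + 0
      ≡⟨ +-identityʳ _ ⟩
    p₁ * pSum (λ λ′ → revlex≤ λ′ (replicate r 1)) (partitionsFuel f S 1)
      ≡⟨ cong (_*_ (p₁)) (pSum-revlex≤-ones r f 1 ≤-refl S≤f) ⟩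
    p₁ ^ suc r ∎
    where
    S : ℕ
    S = size (replicate r 1)

  pSum-revlex≤-twosOnes : ∀ j r f m → 2 ≤ m → size (twosOnes j r) ≤ f →
    pSum (λ λ′ → revlex≤ λ′ (twosOnes j r)) (partitionsFuel f (size (twosOnes j r)) m) ≡
    p₁ ^ r * pParts≤2 (j ℕ.+ j)
  pSum-revlex≤-twosOnes zero r f m 2≤m S≤f =
    trans (pSum-revlex≤-ones r f m (≤-trans (s≤s z≤n) 2≤m) S≤f) (sym (*-identityʳ _))
  pSum-revlex≤-twosOnes (suc j) r (suc f) (suc (suc m)) (s≤s (s≤s z≤n)) (s≤s 1+S≤f) = begin
    pSum (λ λ′ → revlex≤ λ′ (twosOnes (suc j) r)) (partitionsFuel (suc f) (suc (suc S)) (2 ℕ.+ m))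
      ≡⟨ pSum-firstParts≤ 2 f (suc S) m (λ _ _ → refl) ⟩
    p₁ * pSum (λ _ → true) (partitionsFuel f (suc S) 1)
      + (p₂ * pSum (λ λ′ → revlex≤ λ′ (twosOnes j r)) (partitionsFuel f S 2) + + 0)
      ≡⟨ cong₂ (λ X Y → p₁ * X + (p₂ * Y + + 0))
               (pSum-ones f (suc S) 1+S≤f refl)
               (pSum-revlex≤-twosOnes j r f 2 ≤-refl (≤-trans (n≤1+n S) 1+S≤f)) ⟩
    p₁ ^ suc (suc S) + (p₂ * (p₁ ^ r * P) + + 0)
      ≡⟨ cong (λ s → p₁ ^ suc (suc s) + (p₂ * (p₁ ^ r * P) + + 0)) (size-twosOnes j r) ⟩
    p₁ ^ (suc (suc (j ℕ.+ j)) ℕ.+ r) + (p₂ * (p₁ ^ r * P) + + 0)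
      ≡⟨ cong (λ X → X + (p₂ * (p₁ ^ r * P) + + 0)) (^-distribˡ-+-* p₁ (suc (suc (j ℕ.+ j))) r) ⟩
    p₁ ^ suc (suc (j ℕ.+ j)) * p₁ ^ r + (p₂ * (p₁ ^ r * P) + + 0)
      ≡⟨ factor (p₁ ^ suc (suc (j ℕ.+ j))) (p₁ ^ r) p₂ P ⟩
    p₁ ^ r * (p₁ ^ suc (suc (j ℕ.+ j)) + p₂ * P)
      ≡⟨ cong (_*_ (p₁ ^ r)) (sym (pParts≤2-suc+suc j)) ⟩
    p₁ ^ r * pParts≤2 (suc j ℕ.+ suc j) ∎
    where
    S : ℕ
    S = size (twosOnes j r)
    P : ℤ
    P = pParts≤2 (j ℕ.+ j)
    factor : ∀ X U P₂ Y → X * U + (P₂ * (U * Y) + + 0) ≡ U * (X + P₂ * Y)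
    factor = solve-∀

  pSum-revlex≤-twos : ∀ j f m → 2 ≤ m → size (twos j) ≤ f →
    pSum (λ λ′ → revlex≤ λ′ (twos j)) (partitionsFuel f (size (twos j)) m) ≡ pParts≤2 (j ℕ.+ j)
  pSum-revlex≤-twos j f m 2≤m =
    subst (λ μ → size μ ≤ f → pSum (λ λ′ → revlex≤ λ′ μ) (partitionsFuel f (size μ) m) ≡ pParts≤2 (j ℕ.+ j))
          (++-identityʳ (twos j))
          (λ S≤f → trans (pSum-revlex≤-twosOnes j 0 f m 2≤m S≤f) (*-identityˡ (pParts≤2 (j ℕ.+ j))))

  ψ-twos : ∀ j → ψ (twos j) xs ≡ pParts≤2 (j ℕ.+ j)
  ψ-twos zero    = refl
  ψ-twos (suc j) = begin
    ψ (twos (suc j)) xs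
      ≡⟨ pSum-firstParts≤ 2 (suc S) (suc S) S (λ _ _ → refl) ⟩
    p₁ * pSum (λ λ′ → revlex≤ (replicate (suc S) 1) λ′ ∧ true) (partitionsFuel (suc S) (suc S) 1)
      + (p₂ * pSum (λ λ′ → revlex≤ λ′ (twos j)) (partitionsFuel (suc S) S 2) + + 0)
      ≡⟨ cong₂ (λ X Y → p₁ * X + (p₂ * Y + + 0))
               (pSum-ones (suc S) (suc S) ≤-refl (cong (_∧ true) (revlex≤-ones-refl (suc S))))
               (pSum-revlex≤-twos j (suc S) 2 ≤-refl (n≤1+n S)) ⟩
    p₁ ^ suc (suc S) + (p₂ * pParts≤2 (j ℕ.+ j) + + 0)
      ≡⟨ cong₂ (λ s Y → p₁ ^ suc (suc s) + Y) (size-twos j) (+-identityʳ _) ⟩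
    p₁ ^ suc (suc (j ℕ.+ j)) + p₂ * pParts≤2 (j ℕ.+ j)
      ≡⟨ sym (pParts≤2-suc+suc j) ⟩
    pParts≤2 (suc j ℕ.+ suc j) ∎
    where
    S : ℕ
    S = size (twos j)

  ψ-shape : ∀ k r → ψ (shape k r) xs ≡ pParts≤2 (3 ℕ.+ (k ℕ.+ k ℕ.+ r)) + p₃ * p₁ ^ r * ψ (twos k) xs
  ψ-shape k r = begin
    ψ (shape k r) xs
      ≡⟨ pSum-firstParts≤ 3 (2 ℕ.+ S) (2 ℕ.+ S) S (λ _ _ → refl) ⟩
    p₁ * pSum (λ λ′ → revlex≤ (replicate (2 ℕ.+ S) 1) λ′ ∧ true) (partitionsFuel (2 ℕ.+ S) (2 ℕ.+ S) 1)
      + (p₂ * pSum (λ _ → true) (partitionsFuel (2 ℕ.+ S) (1 ℕ.+ S) 2)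
      + (p₃ * pSum (λ λ′ → revlex≤ λ′ (twosOnes k r)) (partitionsFuel (2 ℕ.+ S) S 3) + + 0))
      ≡⟨ cong₂ (λ X Y → p₁ * X + Y)
               (pSum-ones (2 ℕ.+ S) (2 ℕ.+ S) ≤-refl (cong (_∧ true) (revlex≤-ones-refl (2 ℕ.+ S))))
               (cong₂ (λ Y Z → p₂ * Y + (p₃ * Z + + 0))
                      (pSum-parts≤2 (2 ℕ.+ S) (1 ℕ.+ S) (n≤1+n _))
                      (pSum-revlex≤-twosOnes k r (2 ℕ.+ S) 3 (s≤s (s≤s z≤n)) (≤-trans (n≤1+n S) (n≤1+n _)))) ⟩
    p₁ ^ (3 ℕ.+ S) + (p₂ * pParts≤2 (1 ℕ.+ S) + (p₃ * (p₁ ^ r * pParts≤2 (k ℕ.+ k)) + + 0))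
      ≡⟨ regroup (p₁ ^ (3 ℕ.+ S)) (p₂ * pParts≤2 (1 ℕ.+ S)) p₃ (p₁ ^ r) (pParts≤2 (k ℕ.+ k)) ⟩
    pParts≤2 (3 ℕ.+ S) + p₃ * p₁ ^ r * pParts≤2 (k ℕ.+ k)
      ≡⟨ cong₂ (λ s Y → pParts≤2 (3 ℕ.+ s) + p₃ * p₁ ^ r * Y) (size-twosOnes k r) (sym (ψ-twos k)) ⟩
    pParts≤2 (3 ℕ.+ (k ℕ.+ k ℕ.+ r)) + p₃ * p₁ ^ r * ψ (twos k) xs ∎
    where
    S : ℕ
    S = size (twosOnes k r)
    regroup : ∀ A B P₃ U Y → A + (B + (P₃ * (U * Y) + + 0)) ≡ (A + B) + P₃ * U * Y
    regroup = solve-∀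

  ψ-shape-odd : ∀ k r → r % 2 ≡ 1 →
    ψ (shape k r) xs ≡ ψ (twos (⌈ r /2⌉ ℕ.+ k ℕ.+ 1)) xs + p₃ * p₁ ^ r * ψ (twos k) xs
  ψ-shape-odd k r r-odd = begin
    ψ (shape k r) xs                                    ≡⟨ ψ-shape k r ⟩
    pParts≤2 (3 ℕ.+ (k ℕ.+ k ℕ.+ r)) + rest            ≡⟨ cong (λ n → pParts≤2 n + rest) (size-shape-odd k r r-odd) ⟩
    pParts≤2 (M ℕ.+ M) + rest                           ≡⟨ cong (_+ rest) (sym (ψ-twos M)) ⟩
    ψ (twos M) xs + rest                                ∎
    where
    M : ℕ
    M = ⌈ r /2⌉ ℕ.+ k ℕ.+ 1
    rest : ℤ
    rest = p₃ * p₁ ^ r * ψ (twos k) xs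

  ψ-shape-even : ∀ k r → r % 2 ≡ 0 →
    ψ (shape k r) xs ≡ p₁ * ψ (twos (⌈ r /2⌉ ℕ.+ k ℕ.+ 1)) xs + p₃ * p₁ ^ r * ψ (twos k) xs
  ψ-shape-even k r r-even = begin
    ψ (shape k r) xs                                    ≡⟨ ψ-shape k r ⟩
    pParts≤2 (3 ℕ.+ (k ℕ.+ k ℕ.+ r)) + rest            ≡⟨ cong (λ n → pParts≤2 n + rest) (size-shape-even k r r-even) ⟩
    pParts≤2 (suc (M ℕ.+ M)) + rest                     ≡⟨ cong (_+ rest) (pParts≤2-odd M) ⟩
    p₁ * pParts≤2 (M ℕ.+ M) + rest                  ≡⟨ cong (λ X → p₁ * X + rest) (sym (ψ-twos M)) ⟩
    p₁ * ψ (twos M) xs + rest                       ∎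
    where
    M : ℕ
    M = ⌈ r /2⌉ ℕ.+ k ℕ.+ 1
    rest : ℤ
    rest = p₃ * p₁ ^ r * ψ (twos k) xs

h₁≡p₁ : ∀ xs → h 1 xs ≡ p 1 xs
h₁≡p₁ []       = refl
h₁≡p₁ (x ∷ xs) = trans (cong (λ H₁ → H₁ + x * + 1) (h₁≡p₁ xs)) (+-comm (p 1 xs) (x * + 1))

e₁≡p₁ : ∀ xs → e 1 xs ≡ p 1 xs
e₁≡p₁ []       = refl
e₁≡p₁ (x ∷ xs) = trans (cong (λ E₁ → E₁ + x * + 1) (e₁≡p₁ xs)) (+-comm (p 1 xs) (x * + 1))

h₂+e₂≡p₁² : ∀ xs → h 2 xs + e 2 xs ≡ p 1 xs * p 1 xs
h₂+e₂≡p₁² []       = refl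
h₂+e₂≡p₁² (x ∷ xs) rewrite h₁≡p₁ xs | e₁≡p₁ xs = begin
  (H₂ + x * (P + x * + 1)) + (E₂ + x * P) ≡⟨ expand x P H₂ E₂ ⟩
  (H₂ + E₂) + x * (P + P + x)            ≡⟨ cong (λ S → S + x * (P + P + x)) (h₂+e₂≡p₁² xs) ⟩
  P * P + x * (P + P + x)                ≡⟨ square x P ⟩
  (x * + 1 + P) * (x * + 1 + P)          ∎
  where
  P H₂ E₂ : ℤ
  P = p 1 xs
  H₂ = h 2 xs
  E₂ = e 2 xs
  expand : ∀ x P H₂ E₂ → (H₂ + x * (P + x * + 1)) + (E₂ + x * P) ≡ (H₂ + E₂) + x * (P + P + x)
  expand = solve-∀
  square : ∀ x P → P * P + x * (P + P + x) ≡ (x * + 1 + P) * (x * + 1 + P)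
  square = solve-∀

2h₃+e₃≡p₃+p₁h₂ : ∀ xs → + 2 * h 3 xs + e 3 xs ≡ p 3 xs + p 1 xs * h 2 xs
2h₃+e₃≡p₃+p₁h₂ []       = refl
2h₃+e₃≡p₃+p₁h₂ (x ∷ xs) rewrite h₁≡p₁ xs = begin
  + 2 * (H₃ + x * (H₂ + x * (P + x * + 1))) + (E₃ + x * E₂)
    ≡⟨ expand x P H₂ H₃ E₂ E₃ ⟩
  (+ 2 * H₃ + E₃) + x * (H₂ + E₂) + x * (H₂ + + 2 * x * P + + 2 * x * x)
    ≡⟨ cong₂ (λ A B → A + x * B + x * (H₂ + + 2 * x * P + + 2 * x * x)) (2h₃+e₃≡p₃+p₁h₂ xs) (h₂+e₂≡p₁² xs) ⟩
  (P₃ + P * H₂) + x * (P * P) + x * (H₂ + + 2 * x * P + + 2 * x * x)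
    ≡⟨ collect x P H₂ P₃ ⟩
  (x * (x * (x * + 1)) + P₃) + (x * + 1 + P) * (H₂ + x * (P + x * + 1)) ∎
  where
  P P₃ H₂ H₃ E₂ E₃ : ℤ
  P = p 1 xs
  P₃ = p 3 xs
  H₂ = h 2 xs
  H₃ = h 3 xs
  E₂ = e 2 xs
  E₃ = e 3 xs
  expand : ∀ x P H₂ H₃ E₂ E₃ →
    + 2 * (H₃ + x * (H₂ + x * (P + x * + 1))) + (E₃ + x * E₂) ≡
    (+ 2 * H₃ + E₃) + x * (H₂ + E₂) + x * (H₂ + + 2 * x * P + + 2 * x * x)
  expand = solve-∀
  collect : ∀ x P H₂ P₃ →
    (P₃ + P * H₂) + x * (P * P) + x * (H₂ + + 2 * x * P + + 2 * x * x) ≡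
    (x * (x * (x * + 1)) + P₃) + (x * + 1 + P) * (H₂ + x * (P + x * + 1))
  collect = solve-∀

odd-correction : ∀ xs r (Ψ C : ℤ) →
  (Ψ - h 2 xs * p 1 xs ^ (r ℕ.+ 1) * C) + p 1 xs ^ r * (+ 2 * h 3 xs + e 3 xs) * C ≡ Ψ + p 3 xs * p 1 xs ^ r * C
odd-correction xs r Ψ C = begin
  (Ψ - h 2 xs * p 1 xs ^ (r ℕ.+ 1) * C) + p 1 xs ^ r * (+ 2 * h 3 xs + e 3 xs) * C
    ≡⟨ cong₂ (λ U′ F → (Ψ - h 2 xs * U′ * C) + p 1 xs ^ r * F * C)
             (^-distribˡ-+-* (p 1 xs) r 1) (2h₃+e₃≡p₃+p₁h₂ xs) ⟩
  (Ψ - h 2 xs * (p 1 xs ^ r * (p 1 xs * + 1)) * C) + p 1 xs ^ r * (p 3 xs + p 1 xs * h 2 xs) * C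
    ≡⟨ cancel Ψ C (p 1 xs ^ r) (p 1 xs) (h 2 xs) (p 3 xs) ⟩
  Ψ + p 3 xs * p 1 xs ^ r * C ∎
  where
  cancel : ∀ Ψ C U P₁ H₂ P₃ → (Ψ - H₂ * (U * (P₁ * + 1)) * C) + U * (P₃ + P₁ * H₂) * C ≡ Ψ + P₃ * U * C
  cancel = solve-∀

even-correction : ∀ xs r (Ψ C : ℤ) →
  p 1 xs * (Ψ - h 2 xs * p 1 xs ^ r * C) + p 1 xs ^ r * (+ 2 * h 3 xs + e 3 xs) * C ≡ p 1 xs * Ψ + p 3 xs * p 1 xs ^ r * C
even-correction xs r Ψ C = begin
  p 1 xs * (Ψ - h 2 xs * p 1 xs ^ r * C) + p 1 xs ^ r * (+ 2 * h 3 xs + e 3 xs) * C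
    ≡⟨ cong (λ F → p 1 xs * (Ψ - h 2 xs * p 1 xs ^ r * C) + p 1 xs ^ r * F * C) (2h₃+e₃≡p₃+p₁h₂ xs) ⟩
  p 1 xs * (Ψ - h 2 xs * p 1 xs ^ r * C) + p 1 xs ^ r * (p 3 xs + p 1 xs * h 2 xs) * C
    ≡⟨ cancel Ψ C (p 1 xs ^ r) (p 1 xs) (h 2 xs) (p 3 xs) ⟩
  p 1 xs * Ψ + p 3 xs * p 1 xs ^ r * C ∎
  where
  cancel : ∀ Ψ C U P₁ H₂ P₃ → P₁ * (Ψ - H₂ * U * C) + U * (P₃ + P₁ * H₂) * C ≡ P₁ * Ψ + P₃ * U * C
  cancel = solve-∀

proposition3p4 : (k r : ℕ) → 1 ≤ k → 1 ≤ r → (xs : List ℤ) →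
    (r % 2 ≡ 1 →
      ψ (shape k r) xs ≡
        (ψ (twos (⌈ r /2⌉ ℕ.+ k ℕ.+ 1)) xs - h 2 xs * p 1 xs ^ (r ℕ.+ 1) * ψ (twos k) xs)
        + p 1 xs ^ r * ((+ 2) * h 3 xs + e 3 xs) * ψ (twos k) xs)
  × (r % 2 ≡ 0 →
      ψ (shape k r) xs ≡
        p 1 xs * (ψ (twos (⌈ r /2⌉ ℕ.+ k ℕ.+ 1)) xs - h 2 xs * p 1 xs ^ r * ψ (twos k) xs)
        + p 1 xs ^ r * ((+ 2) * h 3 xs + e 3 xs) * ψ (twos k) xs)
proposition3p4 k r _ _ xs =
    (λ r-odd → trans (ψ-shape-odd xs k r r-odd) (sym (odd-correction xs r ψₘ ψₖ)))
  , (λ r-even → trans (ψ-shape-even xs k r r-even) (sym (even-correction xs r ψₘ ψₖ)))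
  where
  ψₘ ψₖ : ℤ
  ψₘ = ψ (twos (⌈ r /2⌉ ℕ.+ k ℕ.+ 1)) xs
  ψₖ = ψ (twos k) xs
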